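{- Let $G$ be a simple undirected graph with at least one edge. If $\operatorname{th}(G)\le\alpha(G)+1$, then every integer in $[\operatorname{th}(G),\alpha(G)+1]$ belongs to $\operatorname{OTI}(G)$.
   Context: $\alpha(G)$ is the independence number of $G$. Zero forcing on an undirected graph: vertices are blue or white; a blue vertex $u$ with exactly one white neighbor $w$ may force $w$ ($u\to w$). On a digraph the same rule applies with out-neighbors in place of neighbors. A set $\mathcal F$ of forces is a set of forces of $B\subseteq V$ if, starting with exactly $B$ blue, the forces in $\mathcal F$ can be validly performed in some order after which no further force is possible. Put $\mathcal F^{[0]}=B$ and $\mathcal F^{[t+1]}=\mathcal F^{[t]}\cup\{w\notin\mathcal F^{[t]}:(u\to w)\in\mathcal F,\ u\in\mathcal F^{[t]},\ w$ the only (out-)neighbor of $u$ outside $\mathcal F^{[t]}\}$; $\operatorname{pt}(\cdot;\mathcal F)$ is the least $t$ with $\mathcal F^{[t]}=V$ ($\infty$ if none); $\operatorname{pt}(\cdot;B)=\min_{\mathcal F}\operatorname{pt}(\cdot;\mathcal F)$; the throttling number is $\operatorname{th}=\min_{B\subseteq V}(|B|+\operatorname{pt}(\cdot;B))$. An orientation $\vec G$ of $G$ replaces each edge $\{u,v\}$ by exactly one of $(u,v),(v,u)$. $\operatorname{OTI}(G)$ is the set of integers in $[m,M]$ where $m$, $M$ are the minimum and maximum of $\operatorname{th}(\vec G)$ over all orientations $\vec G$ of $G$. -}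

module Defs where

open import Data.Nat using (ℕ; zero; suc; _+_; _≤_)
open import Data.Fin using (Fin)
open import Data.Fin.Subset using (Subset; _∈_; _∉_; ∣_∣; inside)
open import Data.Vec using (_[_]≔_)
open import Data.Bool using (Bool; true; false; T)
open import Data.List using (List; []; _∷_)
open import Data.List.Membership.Propositional using () renaming (_∈_ to _∈ₗ_)
open import Data.Product using (Σ; ∃; ∃-syntax; _×_; _,_)
open import Data.Sum using (_⊎_)
open import Relation.Nullary using (¬_)
open import Relation.Binary.PropositionalEquality using (_≡_)

record Graph (n : ℕ) : Set where
  field
    adj     : Fin n → Fin n → Bool
    adj-sym : ∀ u v → adj u v ≡ adj v u
    adj-irr : ∀ u → adj u u ≡ false
open Graph public

HasEdge : ∀ {n} → Graph n → Set
HasEdge G = ∃[ u ] ∃[ v ] T (adj G u v)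

-- A (di)graph given by its (out-)neighbour relation; an undirected graph
-- is the symmetric relation adj.
Rel : ℕ → Set
Rel n = Fin n → Fin n → Bool

IsOrientation : ∀ {n} → Graph n → Rel n → Set
IsOrientation {n} G D =
  (∀ (u v : Fin n) → T (D u v) → T (adj G u v)) ×
  (∀ (u v : Fin n) → T (adj G u v) →
      (T (D u v) × ¬ T (D v u)) ⊎ (T (D v u) × ¬ T (D u v)))

Independent : ∀ {n} → Graph n → Subset n → Set
Independent G S = ∀ u v → u ∈ S → v ∈ S → ¬ T (adj G u v)

IsIndependenceNumber : ∀ {n} → Graph n → ℕ → Set
IsIndependenceNumber {n} G a =
  (∃[ S ] (Independent G S × ∣ S ∣ ≡ a)) ×
  (∀ (S : Subset n) → Independent G S → ∣ S ∣ ≤ a)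

Force : ℕ → Set
Force n = Fin n × Fin n   -- (u , w) stands for u → w

ValidForce : ∀ {n} → Rel n → Subset n → Fin n → Fin n → Set
ValidForce R S u w =
  u ∈ S × w ∉ S × T (R u w) × (∀ x → T (R u x) → x ∉ S → x ≡ w)

data Run {n : ℕ} (R : Rel n) : Subset n → List (Force n) → Subset n → Set where
  done : ∀ {S} → Run R S [] S
  step : ∀ {S u w L S'} → ValidForce R S u w →
         Run R (S [ w ]≔ inside) L S' → Run R S ((u , w) ∷ L) S'

-- F (given as a list, i.e. the set of its entries together with an order
-- in which they can be performed) is a set of forces of B.
IsForceSetOf : ∀ {n} → Rel n → Subset n → List (Force n) → Set
IsForceSetOf R B F =
  ∃[ S ] (Run R B F S × (∀ u w → ¬ ValidForce R S u w))

Stage : ∀ {n} → Rel n → Subset n → List (Force n) → ℕ → Fin n → Set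
Stage R B F zero x = x ∈ B
Stage R B F (suc t) x =
  Stage R B F t x ⊎
  (¬ Stage R B F t x ×
   ∃[ u ] ((u , x) ∈ₗ F × Stage R B F t u × T (R u x) ×
           (∀ y → T (R u y) → ¬ Stage R B F t y → y ≡ x)))

StageFull : ∀ {n} → Rel n → Subset n → List (Force n) → ℕ → Set
StageFull R B F t = ∀ x → Stage R B F t x

-- th(R) = k, i.e. k = min over B, over force sets F of B, of |B| + pt(F)
-- (pt(F) = least t with F^[t] = V; unfolded as a min over all such t).
IsThrottlingNumber : ∀ {n} → Rel n → ℕ → Set
IsThrottlingNumber {n} R k =
  (∃[ B ] ∃[ F ] ∃[ t ] (IsForceSetOf R B F × StageFull R B F t × ∣ B ∣ + t ≡ k)) ×
  (∀ (B : Subset n) (F : List (Force n)) (t : ℕ) →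
     IsForceSetOf R B F → StageFull R B F t → k ≤ ∣ B ∣ + t)

IsMinOrientedTh : ∀ {n} → Graph n → ℕ → Set
IsMinOrientedTh {n} G m =
  (∃[ D ] (IsOrientation G D × IsThrottlingNumber D m)) ×
  (∀ (D : Rel n) (j : ℕ) → IsOrientation G D → IsThrottlingNumber D j → m ≤ j)

IsMaxOrientedTh : ∀ {n} → Graph n → ℕ → Set
IsMaxOrientedTh {n} G M =
  (∃[ D ] (IsOrientation G D × IsThrottlingNumber D M)) ×
  (∀ (D : Rel n) (j : ℕ) → IsOrientation G D → IsThrottlingNumber D j → j ≤ M)

InOTI : ∀ {n} → Graph n → ℕ → Set
InOTI G k = ∃[ m ] ∃[ M ] (IsMinOrientedTh G m × IsMaxOrientedTh G M × m ≤ k × k ≤ M)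

-- Let m and M be the least and largest throttling numbers of orientations
-- of G.  It suffices to show m ≤ th(G) and α(G) + 1 ≤ M.
--
--  * Lemma 1 (forcing orientation).  Orient every edge used by a force in
--    the direction of that force.  The same forces remain valid, at least
--    as fast, so some orientation has throttling number ≤ th(G).
--  * Lemma 2 (orientation towards an independent set S).  Orient every edge
--    into S.  Then S consists of sinks, which never force, and distinct
--    forces have distinct forcers; a counting argument gives |B| ≥ |S|
--    whenever some time is spent, and B = V when no time is spent.  So
--    this orientation has throttling number ≥ |S| + 1.
--
-- Constructively, m and M must also be shown to exist.  Everything is invariant
-- under pointwise equality of the arc relation, which connects arbitrary
-- relations with their matrix codes.
module Submission where

open import Defs
open import Data.Nat using (ℕ; zero; suc; _+_; _∸_; _≤_; _<_; z≤n; s≤s; _≤?_)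
open import Data.Nat.Properties
  using (≤-refl; ≤-trans; ≤-antisym; ≤-pred; ≮⇒≥; +-suc; +-identityʳ; +-comm; +-cancelˡ-≤;
         m≤m+n; m+n≤o⇒m≤o; m+n≤o⇒n≤o; ∸-cancelʳ-≤; anyUpTo?; module ≤-Reasoning)
open import Data.Fin using (Fin; zero; suc; _≟_) renaming (_<?_ to _<ᶠ?_)
open import Data.Fin.Properties using (any?; all?; <-cmp)
open import Data.Fin.Subset using (Subset; _∈_; _∉_; ∣_∣; inside; ⊤)
open import Data.Fin.Subset.Properties using (_∈?_; anySubset?; ∈⊤; ∣⊤∣≡n; ∣p∣≤n; p⊆q⇒∣p∣≤∣q∣; p⊂q⇒∣p∣<∣q∣)
open import Data.Vec using (Vec; []; _∷_; _[_]≔_; here; there; lookup; tabulate)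
open import Data.Vec.Properties using (updateAt-updates; updateAt-minimal; lookup⇒[]=; []=-injective; lookup∘tabulate)
open import Data.Bool using (Bool; true; false; T; not; _∧_)
open import Data.Bool.Properties using (T-∧; T-≡)
open import Data.List using (List; []; _∷_; length)
open import Data.List.Relation.Unary.Any using (here; there)
open import Data.List.Membership.Propositional using () renaming (_∈_ to _∈ₗ_)
import Data.List.Membership.DecPropositional as ListMembership
open import Data.Product using (∃; ∃-syntax; _×_; _,_; proj₁; proj₂)
open import Data.Product.Properties using (≡-dec)
open import Data.Sum using (_⊎_; inj₁; inj₂) renaming (map to ⊎-map)
open import Data.Empty using (⊥)
open import Data.Unit using (tt)
open import Function using (_∘_)
open import Function.Bundles using (Equivalence)
open import Relation.Nullary using (¬_; Dec; yes; no; does; contradiction)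
open import Relation.Nullary.Decidable using (map′; _×-dec_; _⊎-dec_; _→-dec_; ¬?; T?; dec-true; dec-false)
open import Relation.Binary.Definitions using (tri<; tri≈; tri>)
open import Relation.Binary.PropositionalEquality
  using (_≡_; _≢_; refl; sym; trans; cong; cong₂; subst; subst₂)

colour-card : ∀ {n} (S : Subset n) w → w ∉ S → ∣ S [ w ]≔ inside ∣ ≡ suc ∣ S ∣
colour-card (true ∷ S)  zero    w∉S = contradiction here w∉S
colour-card (false ∷ S) zero    w∉S = refl
colour-card (true ∷ S)  (suc w) w∉S = cong suc (colour-card S w (w∉S ∘ there))
colour-card (false ∷ S) (suc w) w∉S = colour-card S w (w∉S ∘ there)

module _ {n : ℕ} where

  ∈-colour : ∀ {S : Subset n} {x} w → x ∈ S → x ∈ S [ w ]≔ inside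
  ∈-colour {S} {x} w x∈S with x ≟ w
  ... | yes refl = updateAt-updates w S x∈S
  ... | no x≢w   = updateAt-minimal x w S x≢w x∈S

  colour-∈ : ∀ (S : Subset n) w → w ∈ S [ w ]≔ inside
  colour-∈ S w = updateAt-updates w S (lookup⇒[]= w S refl)

  colour-inv : ∀ (S : Subset n) {x} w → x ∈ S [ w ]≔ inside → x ≢ w → x ∈ S
  colour-inv S {x} w x∈ x≢w with lookup S x in eq
  ... | true  = lookup⇒[]= x S eq
  ... | false = contradiction ([]=-injective x∈ (updateAt-minimal x w S x≢w (lookup⇒[]= x S eq))) λ ()

  full-card : ∀ (S : Subset n) → (∀ x → x ∈ S) → ∣ S ∣ ≡ n
  full-card S full =
    ≤-antisym (∣p∣≤n S) (subst (_≤ ∣ S ∣) (∣⊤∣≡n n) (p⊆q⇒∣p∣≤∣q∣ {p = ⊤} (λ _ → full _)))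

  missing-card : ∀ (S : Subset n) x → x ∉ S → suc ∣ S ∣ ≤ n
  missing-card S x x∉S = subst (suc ∣ S ∣ ≤_) (∣⊤∣≡n n) (p⊂q⇒∣p∣<∣q∣ ((λ _ → ∈⊤) , x , ∈⊤ , x∉S))

module _ {n : ℕ} {R : Rel n} where

  run-grows : ∀ {S L S' x} → Run R S L S' → x ∈ S → x ∈ S'
  run-grows done x∈S = x∈S
  run-grows (step {w = w} _ run) x∈S = run-grows run (∈-colour w x∈S)

  run-target : ∀ {S L S' u x} → Run R S L S' → (u , x) ∈ₗ L → x ∈ S'
  run-target (step {S = S} {w = w} _ run) (here refl) = run-grows run (colour-∈ S w)
  run-target (step _ run)                 (there m)   = run-target run m

  run-fresh : ∀ {S L S' u x} → Run R S L S' → (u , x) ∈ₗ L → x ∉ S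
  run-fresh (step (_ , w∉S , _) _) (here refl) = w∉S
  run-fresh (step {w = w} _ run)   (there m)   = run-fresh run m ∘ ∈-colour w

  -- No edge is used by forces in both directions: the later force would
  -- target a vertex that was already blue as the earlier forcer.
  run-no-both : ∀ {S L S' u v} → Run R S L S' → (u , v) ∈ₗ L → (v , u) ∈ₗ L → ⊥
  run-no-both (step (u∈S , u∉S , _) _)   (here refl) (here refl) = u∉S u∈S
  run-no-both (step {w = w} (u∈S , _) run) (here refl) (there m)   = run-fresh run m (∈-colour w u∈S)
  run-no-both (step {w = w} (u∈S , _) run) (there m)   (here refl) = run-fresh run m (∈-colour w u∈S)
  run-no-both (step _ run)               (there m)   (there m')  = run-no-both run m m'

  run-length : ∀ {S L S'} → Run R S L S' → length L + ∣ S ∣ ≡ ∣ S' ∣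
  run-length done = refl
  run-length {S} {(_ , w) ∷ L} (step (_ , w∉S , _) run) =
    trans (sym (+-suc (length L) ∣ S ∣)) (trans (cong (length L +_) (sym (colour-card S w w∉S))) (run-length run))

  stage-origin : ∀ {B F} t {x} → Stage R B F t x → x ∈ B ⊎ ∃ λ u → (u , x) ∈ₗ F
  stage-origin zero    x∈B                    = inj₁ x∈B
  stage-origin (suc t) (inj₁ earlier)         = stage-origin t earlier
  stage-origin (suc t) (inj₂ (_ , u , m , _)) = inj₂ (u , m)

  run-final-full : ∀ {B F S t} → Run R B F S → StageFull R B F t → ∀ x → x ∈ S
  run-final-full {t = t} run full x with stage-origin t (full x)
  ... | inj₁ x∈B    = run-grows run x∈B
  ... | inj₂ (_ , m) = run-target run m

  Exhausted : Subset n → Fin n → Set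
  Exhausted Q x = ∀ y → T (R x y) → y ∈ Q

  -- Forcers are never exhausted, and are exhausted right after forcing;
  -- hence forcers are distinct and avoid any initially exhausted set E.
  forcers-bound : ∀ {Q L Q'} → Run R Q L Q' → (E : Subset n) →
                  (∀ x → x ∈ E → Exhausted Q x) → ∣ E ∣ + length L ≤ n
  forcers-bound done E _ = subst (_≤ n) (sym (+-identityʳ ∣ E ∣)) (∣p∣≤n E)
  forcers-bound {Q} {(u , w) ∷ L} (step (_ , w∉Q , uw , only) run) E exhausted =
    subst (_≤ n) count (forcers-bound run (E [ u ]≔ inside) exhausted′)
    where
    u∉E : u ∉ E
    u∉E u∈E = w∉Q (exhausted u u∈E w uw)

    count : ∣ E [ u ]≔ inside ∣ + length L ≡ ∣ E ∣ + suc (length L)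
    count = trans (cong (_+ length L) (colour-card E u u∉E)) (sym (+-suc ∣ E ∣ (length L)))

    exhausted′ : ∀ x → x ∈ E [ u ]≔ inside → Exhausted (Q [ w ]≔ inside) x
    exhausted′ x x∈E′ y xy with x ≟ u | y ∈? Q
    ... | no x≢u  | _        = ∈-colour w (exhausted x (colour-inv E u x∈E′ x≢u) y xy)
    ... | yes _   | yes y∈Q  = ∈-colour w y∈Q
    ... | yes refl | no y∉Q  = subst (_∈ Q [ w ]≔ inside) (sym (only y xy y∉Q)) (colour-∈ Q w)

module _ {n : ℕ} (R : Rel n) where

  validForce? : ∀ S u w → Dec (ValidForce R S u w)
  validForce? S u w =
    (u ∈? S) ×-dec ¬? (w ∈? S) ×-dec T? (R u w) ×-dec
    all? (λ x → T? (R u x) →-dec (¬? (x ∈? S) →-dec (x ≟ w)))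

  forceSet? : ∀ B F → Dec (IsForceSetOf R B F)
  forceSet? B [] = map′ (λ stuck → B , done , stuck) (λ { (_ , done , stuck) → stuck })
    (all? λ u → all? λ w → ¬? (validForce? B u w))
  forceSet? B ((u , w) ∷ L) with validForce? B u w
  ... | no invalid = no λ { (_ , step valid _ , _) → invalid valid }
  ... | yes valid  = map′ (λ { (S , run , stuck) → S , step valid run , stuck })
                          (λ { (S , step _ run , stuck) → S , run , stuck })
                          (forceSet? (B [ w ]≔ inside) L)

  stage? : ∀ B F t x → Dec (Stage R B F t x)
  stage? B F zero    x = x ∈? B
  stage? B F (suc t) x =
    stage? B F t x ⊎-dec
    (¬? (stage? B F t x) ×-dec
     any? λ u → ListMembership._∈?_ (≡-dec _≟_ _≟_) (u , x) F ×-dec stage? B F t u ×-dec T? (R u x) ×-dec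
                all? λ y → T? (R u y) →-dec (¬? (stage? B F t y) →-dec (y ≟ x)))

  stageFull? : ∀ B F t → Dec (StageFull R B F t)
  stageFull? B F t = all? (stage? B F t)

  -- A force set colours one new vertex per force, so has at most n forces.
  forceSet-length : ∀ {B F} → IsForceSetOf R B F → length F ≤ n
  forceSet-length {B} {F} (S , run , _) = m+n≤o⇒m≤o (length F) (subst (_≤ n) (sym (run-length run)) (∣p∣≤n S))

Searchable : Set → Set₁
Searchable A = ∀ {P : A → Set} → (∀ a → Dec (P a)) → Dec (∃ P)

search-× : ∀ {A B} → Searchable A → Searchable B → Searchable (A × B)
search-× searchA searchB P? =
  map′ (λ { (a , b , p) → (a , b) , p }) (λ { ((a , b) , p) → a , b , p })
       (searchA λ a → searchB λ b → P? (a , b))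

search-Vec : ∀ {A} → Searchable A → ∀ k → Searchable (Vec A k)
search-Vec searchA zero    P? = map′ ([] ,_) (λ { ([] , p) → p }) (P? [])
search-Vec searchA (suc k) P? =
  map′ (λ { (a , v , p) → a ∷ v , p }) (λ { (a ∷ v , p) → a , v , p })
       (searchA λ a → search-Vec searchA k (P? ∘ (a ∷_)))

search-List≤ : ∀ {A} → Searchable A → ∀ L {P : List A → Set} → (∀ xs → Dec (P xs)) →
               Dec (∃ λ xs → length xs ≤ L × P xs)
search-List≤ searchA zero P? = map′ (λ p → [] , z≤n , p) (λ { ([] , _ , p) → p }) (P? [])
search-List≤ searchA (suc L) {P} P? =
  map′ into back (P? [] ⊎-dec searchA λ a → search-List≤ searchA L (P? ∘ (a ∷_)))
  where
  into : P [] ⊎ (∃ λ a → ∃ λ xs → length xs ≤ L × P (a ∷ xs)) → ∃ λ xs → length xs ≤ suc L × P xs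
  into (inj₁ p)                = [] , z≤n , p
  into (inj₂ (a , xs , l , p)) = a ∷ xs , s≤s l , p
  back : (∃ λ xs → length xs ≤ suc L × P xs) → P [] ⊎ (∃ λ a → ∃ λ xs → length xs ≤ L × P (a ∷ xs))
  back ([] , _ , p)           = inj₁ p
  back (a ∷ xs , s≤s l , p)   = inj₂ (a , xs , l , p)

least : ∀ {P : ℕ → Set} → (∀ j → Dec (P j)) → ∀ {N} → P N → ∃ λ m → P m × (∀ j → P j → m ≤ j)
least {P} P? {N} pN = descend N N ≤-refl pN
  where
  descend : ∀ k m → m ≤ k → P m → ∃ λ m → P m × (∀ j → P j → m ≤ j)
  descend zero zero z≤n pm = zero , pm , λ _ _ → z≤n
  descend (suc k) m m≤k pm with anyUpTo? P? m
  ... | yes (j , j<m , pj) = descend k j (≤-pred (≤-trans j<m m≤k)) pj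
  ... | no none            = m , pm , λ j pj → ≮⇒≥ (λ j<m → none (j , j<m , pj))

argmin : ∀ {A} {Q : A → Set} → Searchable A → (∀ a → Dec (Q a)) → (f : A → ℕ) →
         ∀ {a₀} → Q a₀ → ∃ λ a → Q a × (∀ b → Q b → f a ≤ f b)
argmin {Q = Q} searchA Q? f {a₀} qa₀ =
  let (_ , (a , qa , fa≤m) , minimal) = least below? {f a₀} (a₀ , qa₀ , ≤-refl)
  in a , qa , λ b qb → ≤-trans fa≤m (minimal (f b) (b , qb , ≤-refl))
  where
  below? : ∀ j → Dec (∃ λ a → Q a × f a ≤ j)
  below? j = searchA λ a → Q? a ×-dec (f a ≤? j)

argmax : ∀ {A} {Q : A → Set} → Searchable A → (∀ a → Dec (Q a)) → (f : A → ℕ) →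
         ∀ N → (∀ a → Q a → f a ≤ N) → ∀ {a₀} → Q a₀ → ∃ λ a → Q a × (∀ b → Q b → f b ≤ f a)
argmax searchA Q? f N bounded qa₀ =
  let (a , qa , minimal) = argmin searchA Q? (λ a → N ∸ f a) qa₀
  in a , qa , λ b qb → ∸-cancelʳ-≤ (bounded b qb) (minimal b qb)

-- Every digraph has a throttling number: the least achievable cost, which
-- exists because achievability is decidable and cost n is achievable.

module _ {n : ℕ} (R : Rel n) where

  CostsAtMost : Subset n → List (Force n) → ℕ → ℕ → Set
  CostsAtMost B F t j = IsForceSetOf R B F × StageFull R B F t × ∣ B ∣ + t ≤ j

  Achievable : ℕ → Set
  Achievable j = ∃[ B ] ∃[ F ] ∃[ t ] CostsAtMost B F t j

  achievable? : ∀ j → Dec (Achievable j)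
  achievable? j = map′ into back
    (anySubset? λ B → search-List≤ (search-× any? any?) n λ F → anyUpTo? (λ t →
       forceSet? R B F ×-dec stageFull? R B F t ×-dec (∣ B ∣ + t ≤? j)) (suc j))
    where
    into : (∃ λ B → ∃ λ F → length F ≤ n × ∃ λ t → t < suc j × CostsAtMost B F t j) → Achievable j
    into (B , F , _ , t , _ , witness) = B , F , t , witness
    back : Achievable j → ∃ λ B → ∃ λ F → length F ≤ n × ∃ λ t → t < suc j × CostsAtMost B F t j
    back (B , F , t , witness@(fs , _ , cost)) =
      B , F , forceSet-length R fs , t , s≤s (m+n≤o⇒n≤o ∣ B ∣ cost) , witness

  achievable-all : Achievable n
  achievable-all =
    ⊤ , [] , 0 , (⊤ , done , λ _ _ valid → proj₁ (proj₂ valid) ∈⊤) , (λ _ → ∈⊤) ,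
    subst (_≤ n) (sym (trans (+-identityʳ _) (∣⊤∣≡n n))) ≤-refl

  throttling-exists : ∃ (IsThrottlingNumber R)
  throttling-exists with least achievable? achievable-all
  ... | k , (B , F , t , fs , full , cost) , minimal =
    k , (B , F , t , fs , full , ≤-antisym cost (minimal _ (B , F , t , fs , full , ≤-refl))) ,
    λ B F t fs full → minimal _ (B , F , t , fs , full , ≤-refl)

  -- The throttling number is used only through its specification; keeping
  -- it opaque stops the type checker from running the search.
  opaque
    th : ℕ
    th = proj₁ throttling-exists

    th-spec : IsThrottlingNumber R th
    th-spec = proj₂ throttling-exists

  throttling-≤ : ∀ {k j} → IsThrottlingNumber R k → Achievable j → k ≤ j
  throttling-≤ (_ , minimal) (B , F , t , fs , full , cost) = ≤-trans (minimal B F t fs full) cost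

  throttling-unique : ∀ {j k} → IsThrottlingNumber R j → IsThrottlingNumber R k → j ≡ k
  throttling-unique thj@((B , F , t , fs , full , refl) , _) thk@((B′ , F′ , t′ , fs′ , full′ , refl) , _) =
    ≤-antisym (throttling-≤ thj (B′ , F′ , t′ , fs′ , full′ , ≤-refl)) (throttling-≤ thk (B , F , t , fs , full , ≤-refl))

_≐_ : ∀ {n} → Rel n → Rel n → Set
R ≐ R′ = ∀ u v → R u v ≡ R′ u v

≐-sym : ∀ {n} {R R′ : Rel n} → R ≐ R′ → R′ ≐ R
≐-sym e u v = sym (e u v)

arc-resp : ∀ {n} {R R′ : Rel n} → R ≐ R′ → ∀ {u v} → T (R u v) → T (R′ u v)
arc-resp e {u} {v} = subst T (e u v)

validForce-resp : ∀ {n} {R R′ : Rel n} → R ≐ R′ → ∀ {S u w} → ValidForce R S u w → ValidForce R′ S u w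
validForce-resp e (u∈S , w∉S , uw , only) =
  u∈S , w∉S , arc-resp e uw , λ x ux → only x (arc-resp (≐-sym e) ux)

module _ {n : ℕ} {R R′ : Rel n} where

  run-resp : R ≐ R′ → ∀ {S L S'} → Run R S L S' → Run R′ S L S'
  run-resp e done           = done
  run-resp e (step valid run) = step (validForce-resp e valid) (run-resp e run)

  forceSet-resp : R ≐ R′ → ∀ {B F} → IsForceSetOf R B F → IsForceSetOf R′ B F
  forceSet-resp e (S , run , stuck) = S , run-resp e run , λ u w → stuck u w ∘ validForce-resp (≐-sym e)

  orientation-resp : R ≐ R′ → ∀ {G : Graph n} → IsOrientation G R → IsOrientation G R′
  orientation-resp e (onEdges , oneWay) =
    (λ u v → onEdges u v ∘ arc-resp (≐-sym e)) ,
    λ u v uv → ⊎-map transfer transfer (oneWay u v uv)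
    where
    transfer : ∀ {a b} → T (R a b) × ¬ T (R b a) → T (R′ a b) × ¬ T (R′ b a)
    transfer (ab , ¬ba) = arc-resp e ab , ¬ba ∘ arc-resp (≐-sym e)

stage-resp : ∀ {n} {R R′ : Rel n} → R ≐ R′ → ∀ {B F} t {x} → Stage R B F t x → Stage R′ B F t x
stage-resp e zero    x∈B           = x∈B
stage-resp e (suc t) (inj₁ earlier) = inj₁ (stage-resp e t earlier)
stage-resp e (suc t) (inj₂ (new , u , m , su , ux , only)) =
  inj₂ (new ∘ stage-resp (≐-sym e) t , u , m , stage-resp e t su , arc-resp e ux ,
        λ y uy ¬s → only y (arc-resp (≐-sym e) uy) (¬s ∘ stage-resp e t))

throttling-resp : ∀ {n} {R R′ : Rel n} → R ≐ R′ → ∀ {k} → IsThrottlingNumber R k → IsThrottlingNumber R′ k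
throttling-resp e ((B , F , t , fs , full , cost) , minimal) =
  (B , F , t , forceSet-resp e fs , (λ x → stage-resp e t (full x)) , cost) ,
  λ B F t fs full → minimal B F t (forceSet-resp (≐-sym e) fs) (λ x → stage-resp (≐-sym e) t (full x))

choose : ∀ {A B : Set} → Dec A → Dec B → Bool → Bool
choose (yes _) _       _ = true
choose (no _)  (yes _) _ = false
choose (no _)  (no _)  c = c

choose-yes : ∀ {A B : Set} (a : Dec A) (b : Dec B) c → A → T (choose a b c)
choose-yes (yes _) _ _ _ = tt
choose-yes (no ¬a) _ _ x = contradiction x ¬a

choose-flip : ∀ {A B : Set} → ¬ (A × B) → (a : Dec A) (b : Dec B) {c c′ : Bool} →
              c′ ≡ not c → choose b a c′ ≡ not (choose a b c)
choose-flip exclusive (yes x) (yes y) _  = contradiction (x , y) exclusive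
choose-flip exclusive (yes _) (no _)  _  = refl
choose-flip exclusive (no _)  (yes _) _  = refl
choose-flip exclusive (no _)  (no _)  c′ = c′

order-flip : ∀ {n} {u v : Fin n} → u ≢ v → does (v <ᶠ? u) ≡ not (does (u <ᶠ? v))
order-flip {u = u} {v} u≢v with <-cmp u v
... | tri< u<v _ v≮u = trans (dec-false (v <ᶠ? u) v≮u) (cong not (sym (dec-true (u <ᶠ? v) u<v)))
... | tri≈ _ u≡v _   = contradiction u≡v u≢v
... | tri> u≮v _ v<u = trans (dec-true (v <ᶠ? u) v<u) (cong not (sym (dec-false (u <ᶠ? v) u≮v)))

exactly-one : ∀ b → (T b × ¬ T (not b)) ⊎ (T (not b) × ¬ T b)
exactly-one true  = inj₁ (tt , λ ())
exactly-one false = inj₂ (tt , λ ())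

-- Given a decidable set X of preferred arcs, never containing both
-- directions of an edge, G has an orientation containing every preferred
-- arc that is an edge; the remaining edges are oriented by index order.
module PreferredOrientation {n : ℕ} (G : Graph n) (X : Fin n → Fin n → Set) (X? : ∀ u v → Dec (X u v))
                            (X-antisym : ∀ u v → T (adj G u v) → ¬ (X u v × X v u)) where

  prefer : Fin n → Fin n → Bool
  prefer u v = choose (X? u v) (X? v u) (does (u <ᶠ? v))

  D : Rel n
  D u v = adj G u v ∧ prefer u v

  isOrientation : IsOrientation G D
  isOrientation = (λ u v → proj₁ ∘ Equivalence.to T-∧) , one-way
    where
    one-way : ∀ u v → T (adj G u v) → (T (D u v) × ¬ T (D v u)) ⊎ (T (D v u) × ¬ T (D u v))
    one-way u v uv = subst₂ (λ p q → (T p × ¬ T q) ⊎ (T q × ¬ T p)) (sym forward) (sym backward)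
                            (exactly-one (prefer u v))
      where
      u≢v : u ≢ v
      u≢v refl = subst T (adj-irr G u) uv
      forward : D u v ≡ prefer u v
      forward = cong (_∧ prefer u v) (Equivalence.to T-≡ uv)
      backward : D v u ≡ not (prefer u v)
      backward = cong₂ _∧_ (Equivalence.to T-≡ (subst T (adj-sym G u v) uv))
                           (choose-flip (X-antisym u v uv) (X? u v) (X? v u) (order-flip u≢v))

  keeps : ∀ u v → T (adj G u v) → X u v → T (D u v)
  keeps u v uv x = Equivalence.from T-∧ (uv , choose-yes (X? u v) (X? v u) _ x)

-- Passing to a sub-relation R′ of R that keeps every arc used by F does
-- not slow the force set F down.
module Restriction {n : ℕ} {R R′ : Rel n} {F : List (Force n)}
                   (sub : ∀ u v → T (R′ u v) → T (R u v))
                   (keep : ∀ u v → (u , v) ∈ₗ F → T (R u v) → T (R′ u v)) where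

  run-restrict : ∀ {S L S'} → Run R S L S' → (∀ {f} → f ∈ₗ L → f ∈ₗ F) → Run R′ S L S'
  run-restrict done _ = done
  run-restrict (step {u = u} {w = w} (u∈S , w∉S , uw , only) run) ⊆F =
    step (u∈S , w∉S , keep u w (⊆F (here refl)) uw , λ x ux → only x (sub u x ux))
         (run-restrict run (⊆F ∘ there))

  stage-restrict : ∀ {B} t {x} → Stage R B F t x → Stage R′ B F t x
  stage-restrict zero    x∈B            = x∈B
  stage-restrict (suc t) (inj₁ earlier) = inj₁ (stage-restrict t earlier)
  stage-restrict {B} (suc t) {x} (inj₂ (_ , u , m , su , ux , only)) with stage? R′ B F t x
  ... | yes earlier = inj₁ earlier
  ... | no new      = inj₂ (new , u , m , stage-restrict t su , keep u x m ux ,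
                            λ y uy ¬s → only y (sub u y uy) (¬s ∘ stage-restrict t))

  forceSet-restrict : ∀ {B t} → IsForceSetOf R B F → StageFull R B F t → IsForceSetOf R′ B F
  forceSet-restrict (S , run , _) full =
    S , run-restrict run (λ m → m) , λ _ w valid → proj₁ (proj₂ valid) (run-final-full run full w)

-- Lemma 1.  Orienting each edge used by a force set of G in the direction
-- of its force gives an orientation for which the same strategy works.
forcing-orientation : ∀ {n} (G : Graph n) {B F t} → IsForceSetOf (adj G) B F → StageFull (adj G) B F t →
                      ∃ λ D → IsOrientation G D × IsForceSetOf D B F × StageFull D B F t
forcing-orientation G {B} {F} {t} fs@(_ , run , _) full =
  D , isOrientation , forceSet-restrict fs full , λ x → stage-restrict t (full x)
  where
  open PreferredOrientation G (λ u v → (u , v) ∈ₗ F) (λ u v → ListMembership._∈?_ (≡-dec _≟_ _≟_) (u , v) F)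
                              (λ u v _ (uv , vu) → run-no-both run uv vu)
  open Restriction {R = adj G} {R′ = D} (proj₁ isOrientation) (λ u v m uv → keeps u v uv m)

min-oriented-≤ : ∀ {n} (G : Graph n) {m t} → IsMinOrientedTh G m → IsThrottlingNumber (adj G) t → m ≤ t
min-oriented-≤ G (_ , minimal) ((B , F , t , fs , full , refl) , _) with forcing-orientation G fs full
... | D , o , fsD , fullD =
  ≤-trans (minimal D (th D) o (th-spec D)) (throttling-≤ D (th-spec D) (B , F , t , fsD , fullD , ≤-refl))

-- Lemma 2.  Orient every edge with an end in the independent set S
-- towards S; this orientation is slower than |S| + 1.
module TowardsIndependent {n : ℕ} (G : Graph n) (S : Subset n) (indep : Independent G S) where

  open PreferredOrientation G (λ _ v → v ∈ S) (λ _ v → v ∈? S)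
                              (λ u v uv (v∈S , u∈S) → indep u v u∈S v∈S uv) public

  -- Vertices of S are sinks: an arc s → y would be an edge whose
  -- preferred direction y → s is kept.
  sink : ∀ s → s ∈ S → ∀ y → ¬ T (D s y)
  sink s s∈S y sy = exclusive (proj₂ isOrientation y s ys)
    where
    ys : T (adj G y s)
    ys = subst T (adj-sym G s y) (proj₁ isOrientation s y sy)
    exclusive : (T (D y s) × ¬ T (D s y)) ⊎ (T (D s y) × ¬ T (D y s)) → ⊥
    exclusive (inj₁ (_ , ¬sy)) = ¬sy sy
    exclusive (inj₂ (_ , ¬ys)) = ¬ys (keeps y s ys s∈S)

  -- Every strategy for D costs more than |S|: with no time spent B is
  -- everything, which exceeds S because an edge leaves S; otherwise the
  -- forcers avoid the sinks, so there are at most n − |S| forces, i.e.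
  -- |B| ≥ |S|.
  cost-bound : HasEdge G → ∀ B F t → IsForceSetOf D B F → StageFull D B F t → ∣ S ∣ + 1 ≤ ∣ B ∣ + t
  cost-bound (u , v , uv) B F zero _ full =
    subst₂ _≤_ (+-comm 1 ∣ S ∣) (sym (trans (+-identityʳ ∣ B ∣) (full-card B full)))
           (missing-card S (proj₁ outside-S) (proj₂ outside-S))
    where
    outside-S : ∃ λ x → x ∉ S
    outside-S with u ∈? S
    ... | yes u∈S = v , λ v∈S → indep u v u∈S v∈S uv
    ... | no u∉S  = u , u∉S
  cost-bound _ B F (suc t) (Q , run , _) full =
    begin
      ∣ S ∣ + 1       ≡⟨ +-comm ∣ S ∣ 1 ⟩
      suc ∣ S ∣       ≤⟨ s≤s (≤-trans S≤B (m≤m+n ∣ B ∣ t)) ⟩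
      suc (∣ B ∣ + t) ≡⟨ sym (+-suc ∣ B ∣ t) ⟩
      ∣ B ∣ + suc t   ∎
    where
    open ≤-Reasoning
    S≤B : ∣ S ∣ ≤ ∣ B ∣
    S≤B = +-cancelˡ-≤ (length F) _ _ (begin
      length F + ∣ S ∣ ≡⟨ +-comm (length F) ∣ S ∣ ⟩
      ∣ S ∣ + length F ≤⟨ forcers-bound run S (λ s s∈S y sy → contradiction sy (sink s s∈S y)) ⟩
      n                ≡⟨ sym (full-card Q (run-final-full run full)) ⟩
      ∣ Q ∣            ≡⟨ sym (run-length run) ⟩
      length F + ∣ B ∣ ∎)

  throttling-bound : HasEdge G → ∀ {k} → IsThrottlingNumber D k → ∣ S ∣ + 1 ≤ k
  throttling-bound edge ((B , F , t , fs , full , refl) , _) = cost-bound edge B F t fs full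

max-oriented-≥ : ∀ {n} (G : Graph n) {M S} → HasEdge G → IsMaxOrientedTh G M → Independent G S → ∣ S ∣ + 1 ≤ M
max-oriented-≥ G {S = S} edge (_ , maximal) indep =
  ≤-trans (throttling-bound edge (th-spec D)) (maximal D (th D) isOrientation (th-spec D))
  where open TowardsIndependent G S indep

-- Arc relations coded as Boolean matrices, which can be searched; this is
-- how the least and largest throttling numbers of orientations are found.
Code : ℕ → Set
Code n = Vec (Subset n) n

decode : ∀ {n} → Code n → Rel n
decode c u v = lookup (lookup c u) v

encode : ∀ {n} → Rel n → Code n
encode D = tabulate λ u → tabulate (D u)

decode-encode : ∀ {n} (D : Rel n) → D ≐ decode (encode D)
decode-encode D u v =
  sym (trans (cong (λ row → lookup row v) (lookup∘tabulate (λ u → tabulate (D u)) u)) (lookup∘tabulate (D u) v))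

orientation? : ∀ {n} (G : Graph n) (D : Rel n) → Dec (IsOrientation G D)
orientation? G D =
  all? (λ u → all? λ v → T? (D u v) →-dec T? (adj G u v)) ×-dec
  all? (λ u → all? λ v → T? (adj G u v) →-dec
         ((T? (D u v) ×-dec ¬? (T? (D v u))) ⊎-dec (T? (D v u) ×-dec ¬? (T? (D u v)))))

module OrientedExtremes {n : ℕ} (G : Graph n) where

  IsOrientationCode : Code n → Set
  IsOrientationCode c = IsOrientation G (decode c)

  code-of : ∀ {D j} → IsOrientation G D → IsThrottlingNumber D j →
            IsOrientationCode (encode D) × th (decode (encode D)) ≡ j
  code-of {D} o thD =
    orientation-resp (decode-encode D) {G} o ,
    throttling-unique (decode (encode D)) (th-spec _) (throttling-resp (decode-encode D) thD)

  -- Orienting every edge by index order shows that orientations exist.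
  module IndexOrder = PreferredOrientation G (λ _ _ → ⊥) (λ _ _ → no λ ()) (λ _ _ _ → proj₁)

  some-orientation : IsOrientationCode (encode IndexOrder.D)
  some-orientation = orientation-resp (decode-encode IndexOrder.D) {G} IndexOrder.isOrientation

  min-exists : ∃ (IsMinOrientedTh G)
  min-exists with argmin (search-Vec anySubset? n) (orientation? G ∘ decode) (th ∘ decode)
                         {encode IndexOrder.D} some-orientation
  ... | c , o , minimal =
    th (decode c) , (decode c , o , th-spec _) ,
    λ D j oD thD → subst (th (decode c) ≤_) (proj₂ (code-of oD thD)) (minimal (encode D) (proj₁ (code-of oD thD)))

  max-exists : ∃ (IsMaxOrientedTh G)
  max-exists with argmax (search-Vec anySubset? n) (orientation? G ∘ decode) (th ∘ decode) n
                         (λ c _ → throttling-≤ (decode c) (th-spec _) (achievable-all _))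
                         {encode IndexOrder.D} some-orientation
  ... | c , o , maximal =
    th (decode c) , (decode c , o , th-spec _) ,
    λ D j oD thD → subst (_≤ th (decode c)) (proj₂ (code-of oD thD)) (maximal (encode D) (proj₁ (code-of oD thD)))

corollary3p5 : ∀ (n : ℕ) (G : Graph n) → HasEdge G →
    ∀ (t a : ℕ) → IsThrottlingNumber (adj G) t → IsIndependenceNumber G a →
    t ≤ a + 1 → ∀ (k : ℕ) → t ≤ k → k ≤ a + 1 → InOTI G k
corollary3p5 n G edge t a thG ((S , indep , ∣S∣≡a) , _) _ k t≤k k≤a+1
  with OrientedExtremes.min-exists G | OrientedExtremes.max-exists G
... | m , isMin | M , isMax =
  m , M , isMin , isMax ,
  ≤-trans (min-oriented-≤ G isMin thG) t≤k ,
  ≤-trans k≤a+1 (subst (λ s → s + 1 ≤ M) ∣S∣≡a (max-oriented-≥ G edge isMax indep))
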